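{- Let $I$ be an arbitrary Bin Packing instance with capacity $W$, and let $a,b,c\in I$ be pairwise distinct items such that $w_a+w_b+w_c=W$ and there is no full pattern containing $a$ whose other items all lie in $I\setminus\{a,b,c\}$. If $I$ admits a perfect packing, then $I$ admits a perfect packing in which $\{a,b,c\}$ is one of the parts.
   Context: A Bin Packing instance consists of a finite set $I$ of items with positive integer weights $w_i$ and a positive integer capacity $W$. A full pattern is a subset $P\subseteq I$ with $\sum_{i\in P}w_i=W$. A perfect packing is a partition of $I$ into full patterns. -}

module Defs where

open import Data.Nat using (ℕ; zero; suc; _+_; _>_)
open import Data.Fin using (Fin)
import Data.Fin
open import Data.Fin.Subset using (Subset; _∈_; _∉_; ⁅_⁆; _∪_)
open import Data.Fin.Subset.Properties using (_∈?_)
open import Data.List using (List; []; _∷_; length; filter)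
open import Data.List.Membership.Propositional using () renaming (_∈_ to _∈L_)
open import Data.Vec using (Vec; []; _∷_)
open import Data.Bool using (true; false)
open import Relation.Binary.PropositionalEquality using (_≡_)

record Instance : Set where
  constructor mkInstance
  field
    n   : ℕ
    w   : Fin n → ℕ
    W   : ℕ
    w>0 : ∀ i → w i > 0
    W>0 : W > 0

open Instance public

weightOf : ∀ {n} → (Fin n → ℕ) → Subset n → ℕ
weightOf {zero}  w []            = 0
weightOf {suc n} w (true  ∷ s)   = w Data.Fin.zero + weightOf (λ i → w (Data.Fin.suc i)) s
weightOf {suc n} w (false ∷ s)   = weightOf (λ i → w (Data.Fin.suc i)) s

FullPattern : (I : Instance) → Subset (n I) → Set
FullPattern I P = weightOf (w I) P ≡ W I

countContaining : ∀ {n} → Fin n → List (Subset n) → ℕ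
countContaining i ps = length (filter (i ∈?_) ps)

record PerfectPacking (I : Instance) (parts : List (Subset (n I))) : Set where
  field
    allFull   : ∀ P → P ∈L parts → FullPattern I P
    partition : ∀ i → countContaining i parts ≡ 1

triple : ∀ {n} → Fin n → Fin n → Fin n → Subset n
triple a b c = ⁅ a ⁆ ∪ (⁅ b ⁆ ∪ ⁅ c ⁆)

-- The part P containing a must meet {b, c}: otherwise P itself would be the
-- forbidden pattern. If P contains b and c, then {a, b, c} ⊆ P are both full,
-- so P = {a, b, c} because weights are positive. If P misses one of them, say
-- c, let Q be the part containing c; P and Q are disjoint, {a, b, c} ⊆ P ∪ Q,
-- and P ∪ Q has weight 2W, so replacing P, Q by {a, b, c} and
-- (P ∪ Q) ∖ {a, b, c} gives another perfect packing.
module Submission where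

open import Defs
open import Data.Nat using (ℕ; zero; suc; _+_; _*_; _≤_; _>_)
open import Data.Nat.Properties
open import Data.Fin using (Fin)
open import Data.Fin.Subset using (Subset; _∈_; _∉_; _⊆_; _∪_; _─_; ⁅_⁆; ⊥; outside)
open import Data.Fin.Subset.Properties
  using (_∈?_; x∈⁅y⁆⇒x≡y; x∈p∪q⁻; x∈p∪q⁺; x∈p∧x∉q⇒x∈p─q; p─q⊆p; ⊆-antisym)
open import Data.List using (List; []; _∷_)
open import Data.List.Membership.Propositional using () renaming (_∈_ to _∈L_)
open import Data.List.Relation.Unary.Any using (here; there) renaming (_─_ to _─ₗ_)
open import Data.Vec using ([]; _∷_; lookup; here; there)
open import Data.Vec.Properties using ([]=⇒lookup; lookup⇒[]=)
open import Data.Bool using (Bool; true; false)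
open import Data.Product using (Σ; _×_; _,_)
open import Data.Sum using (inj₁; inj₂; [_,_])
open import Data.Empty using (⊥-elim)
open import Relation.Nullary using (¬_; yes; no; contradiction)
open import Relation.Binary.PropositionalEquality
  using (_≡_; _≢_; refl; sym; trans; cong; cong₂; subst; module ≡-Reasoning)
open import Data.Nat.Tactic.RingSolver using (solve-∀)
open import Algebra.Properties.CommutativeSemigroup +-commutativeSemigroup using (x∙yz≈y∙xz)

open ≡-Reasoning

private
  variable
    m : ℕ
    i a b c : Fin m
    p q r : Subset m

bit : Bool → ℕ
bit true  = 1
bit false = 0

indicator : Subset m → Fin m → ℕ
indicator p i = bit (lookup p i)

indicator-∈ : i ∈ p → indicator p i ≡ 1
indicator-∈ i∈p rewrite []=⇒lookup i∈p = refl

indicator-∉ : i ∉ p → indicator p i ≡ 0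
indicator-∉ {i = i} {p = p} i∉p with lookup p i in eq
... | true  = contradiction (lookup⇒[]= i p eq) i∉p
... | false = refl

Disjoint : Subset m → Subset m → Set
Disjoint p q = ∀ {i} → i ∈ p → i ∉ q

⁅⁆-disjoint : a ≢ b → Disjoint ⁅ a ⁆ ⁅ b ⁆
⁅⁆-disjoint {a = a} {b = b} a≢b i∈a i∈b =
  a≢b (trans (sym (x∈⁅y⁆⇒x≡y a i∈a)) (x∈⁅y⁆⇒x≡y b i∈b))

∪-disjoint : Disjoint p q → Disjoint p r → Disjoint p (q ∪ r)
∪-disjoint {q = q} {r = r} p#q p#r i∈p i∈q∪r = [ p#q i∈p , p#r i∈p ] (x∈p∪q⁻ q r i∈q∪r)

x∈p─q⇒x∉q : i ∈ p ─ q → i ∉ q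
x∈p─q⇒x∉q {p = _ ∷ _} {q = outside ∷ _} here ()
x∈p─q⇒x∉q {p = _ ∷ _} {q = _ ∷ _} (there i∈p─q) (there i∈q) = x∈p─q⇒x∉q i∈p─q i∈q

indicator-∪ : Disjoint p q → indicator p i + indicator q i ≡ indicator (p ∪ q) i
indicator-∪ {p = p} {q = q} {i = i} p#q with i ∈? p | i ∈? q
... | yes i∈p | _ rewrite indicator-∈ i∈p | indicator-∉ (p#q i∈p)
                        | indicator-∈ (x∈p∪q⁺ {p = p} {q} (inj₁ i∈p)) = refl
... | no i∉p | yes i∈q rewrite indicator-∉ i∉p | indicator-∈ i∈q
                             | indicator-∈ (x∈p∪q⁺ {p = p} {q} (inj₂ i∈q)) = refl
... | no i∉p | no i∉q rewrite indicator-∉ i∉p | indicator-∉ i∉q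
                            | indicator-∉ {p = p ∪ q} (λ i∈p∪q → [ i∉p , i∉q ] (x∈p∪q⁻ p q i∈p∪q)) = refl

indicator-─ : q ⊆ p → indicator q i + indicator (p ─ q) i ≡ indicator p i
indicator-─ {q = q} {p = p} {i = i} q⊆p with i ∈? q | i ∈? p
... | yes i∈q | _ rewrite indicator-∈ i∈q | indicator-∈ (q⊆p i∈q)
                        | indicator-∉ {p = p ─ q} (λ i∈p─q → x∈p─q⇒x∉q i∈p─q i∈q) = refl
... | no i∉q | yes i∈p rewrite indicator-∉ i∉q | indicator-∈ i∈p
                             | indicator-∈ (x∈p∧x∉q⇒x∈p─q i∈p i∉q) = refl
... | no i∉q | no i∉p rewrite indicator-∉ i∉q | indicator-∉ i∉p
                            | indicator-∉ {p = p ─ q} (λ i∈p─q → i∉p (p─q⊆p p q i∈p─q)) = refl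

weightOf-∷ : ∀ (w : Fin (suc m) → ℕ) x p →
  weightOf w (x ∷ p) ≡ bit x * w Fin.zero + weightOf (λ i → w (Fin.suc i)) p
weightOf-∷ w true  p = cong (_+ weightOf (λ i → w (Fin.suc i)) p) (sym (*-identityˡ (w Fin.zero)))
weightOf-∷ w false p = refl

weightOf-additive : ∀ (w : Fin m → ℕ) (p q r : Subset m) →
  (∀ i → indicator p i + indicator q i ≡ indicator r i) →
  weightOf w p + weightOf w q ≡ weightOf w r
weightOf-additive {zero}  w [] [] [] _ = refl
weightOf-additive {suc m} w (x ∷ p) (y ∷ q) (z ∷ r) p+q≡r = begin
  weightOf w (x ∷ p) + weightOf w (y ∷ q)
    ≡⟨ cong₂ _+_ (weightOf-∷ w x p) (weightOf-∷ w y q) ⟩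
  (bit x * w₀ + weightOf w′ p) + (bit y * w₀ + weightOf w′ q)
    ≡⟨ regroup (bit x) (bit y) w₀ (weightOf w′ p) (weightOf w′ q) ⟩
  (bit x + bit y) * w₀ + (weightOf w′ p + weightOf w′ q)
    ≡⟨ cong₂ (λ s t → s * w₀ + t) (p+q≡r Fin.zero)
             (weightOf-additive w′ p q r (λ i → p+q≡r (Fin.suc i))) ⟩
  bit z * w₀ + weightOf w′ r
    ≡⟨ weightOf-∷ w z r ⟨
  weightOf w (z ∷ r) ∎
  where
  w₀ : ℕ
  w₀ = w Fin.zero
  w′ : Fin m → ℕ
  w′ i = w (Fin.suc i)
  regroup : ∀ x y w s t → (x * w + s) + (y * w + t) ≡ (x + y) * w + (s + t)
  regroup = solve-∀

weightOf-⊥ : ∀ (w : Fin m → ℕ) → weightOf w ⊥ ≡ 0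
weightOf-⊥ {zero}  w = refl
weightOf-⊥ {suc m} w = weightOf-⊥ (λ i → w (Fin.suc i))

weightOf-⁅⁆ : ∀ (w : Fin m → ℕ) a → weightOf w ⁅ a ⁆ ≡ w a
weightOf-⁅⁆ {suc m} w Fin.zero    = trans (cong (w Fin.zero +_) (weightOf-⊥ (λ i → w (Fin.suc i)))) (+-identityʳ _)
weightOf-⁅⁆ {suc m} w (Fin.suc a) = weightOf-⁅⁆ (λ i → w (Fin.suc i)) a

∈⇒≤weightOf : ∀ (w : Fin m → ℕ) → i ∈ p → w i ≤ weightOf w p
∈⇒≤weightOf {p = true ∷ p} w here = m≤m+n _ _
∈⇒≤weightOf {p = true ∷ p} w (there i∈p) =
  ≤-trans (∈⇒≤weightOf (λ j → w (Fin.suc j)) i∈p) (m≤n+m _ _)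
∈⇒≤weightOf {p = false ∷ p} w (there i∈p) = ∈⇒≤weightOf (λ j → w (Fin.suc j)) i∈p

weightOf-∪ : ∀ (w : Fin m → ℕ) → Disjoint p q → weightOf w p + weightOf w q ≡ weightOf w (p ∪ q)
weightOf-∪ {p = p} {q = q} w p#q = weightOf-additive w p q (p ∪ q) (λ _ → indicator-∪ p#q)

weightOf-─ : ∀ (w : Fin m → ℕ) → q ⊆ p → weightOf w q + weightOf w (p ─ q) ≡ weightOf w p
weightOf-─ {q = q} {p = p} w q⊆p = weightOf-additive w q (p ─ q) p (λ _ → indicator-─ q⊆p)

weightOf-triple : ∀ (w : Fin m → ℕ) → a ≢ b → a ≢ c → b ≢ c →
  weightOf w (triple a b c) ≡ w a + w b + w c
weightOf-triple {a = a} {b = b} {c = c} w a≢b a≢c b≢c = begin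
  weightOf w (⁅ a ⁆ ∪ (⁅ b ⁆ ∪ ⁅ c ⁆))
    ≡⟨ weightOf-∪ w (∪-disjoint (⁅⁆-disjoint a≢b) (⁅⁆-disjoint a≢c)) ⟨
  weightOf w ⁅ a ⁆ + weightOf w (⁅ b ⁆ ∪ ⁅ c ⁆)
    ≡⟨ cong (weightOf w ⁅ a ⁆ +_) (weightOf-∪ w (⁅⁆-disjoint b≢c)) ⟨
  weightOf w ⁅ a ⁆ + (weightOf w ⁅ b ⁆ + weightOf w ⁅ c ⁆)
    ≡⟨ cong₂ _+_ (weightOf-⁅⁆ w a) (cong₂ _+_ (weightOf-⁅⁆ w b) (weightOf-⁅⁆ w c)) ⟩
  w a + (w b + w c)
    ≡⟨ +-assoc (w a) (w b) (w c) ⟨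
  w a + w b + w c ∎

triple⊆ : a ∈ p → b ∈ p → c ∈ p → triple a b c ⊆ p
triple⊆ {a = a} {p = p} {b = b} {c = c} a∈p b∈p c∈p i∈abc
  with x∈p∪q⁻ ⁅ a ⁆ (⁅ b ⁆ ∪ ⁅ c ⁆) i∈abc
... | inj₁ i∈a = subst (_∈ p) (sym (x∈⁅y⁆⇒x≡y a i∈a)) a∈p
... | inj₂ i∈bc with x∈p∪q⁻ ⁅ b ⁆ ⁅ c ⁆ i∈bc
...   | inj₁ i∈b = subst (_∈ p) (sym (x∈⁅y⁆⇒x≡y b i∈b)) b∈p
...   | inj₂ i∈c = subst (_∈ p) (sym (x∈⁅y⁆⇒x≡y c i∈c)) c∈p

weightOf≡0⇒∉ : ∀ (w : Fin m → ℕ) → (∀ j → w j > 0) → weightOf w p ≡ 0 → i ∉ p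
weightOf≡0⇒∉ w w>0 wp≡0 i∈p = <⇒≱ (w>0 _) (subst (_ ≤_) wp≡0 (∈⇒≤weightOf w i∈p))

full-⊆⇒≡ : ∀ (I : Instance) {p q : Subset (n I)} →
  q ⊆ p → FullPattern I q → FullPattern I p → q ≡ p
full-⊆⇒≡ I {p} {q} q⊆p full-q full-p = ⊆-antisym q⊆p p⊆q
  where
  weight-p─q≡0 : weightOf (w I) (p ─ q) ≡ 0
  weight-p─q≡0 = sym (+-cancelˡ-≡ (W I) 0 _ (begin
    W I + 0                          ≡⟨ +-identityʳ (W I) ⟩
    W I                              ≡⟨ full-p ⟨
    weightOf (w I) p                 ≡⟨ weightOf-─ (w I) q⊆p ⟨
    weightOf (w I) q + weightOf (w I) (p ─ q)
                                     ≡⟨ cong (_+ weightOf (w I) (p ─ q)) full-q ⟩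
    W I + weightOf (w I) (p ─ q)     ∎))
  p⊆q : p ⊆ q
  p⊆q {i} i∈p with i ∈? q
  ... | yes i∈q = i∈q
  ... | no i∉q  = contradiction (x∈p∧x∉q⇒x∈p─q i∈p i∉q) (weightOf≡0⇒∉ (w I) (w>0 I) weight-p─q≡0)

countContaining-∷ : ∀ (i : Fin m) P L → countContaining i (P ∷ L) ≡ indicator P i + countContaining i L
countContaining-∷ i P L with i ∈? P
... | yes i∈P rewrite indicator-∈ i∈P = refl
... | no i∉P  rewrite indicator-∉ i∉P = refl

countContaining-─ₗ : ∀ (i : Fin m) {P} L (P∈L : P ∈L L) →
  countContaining i L ≡ indicator P i + countContaining i (L ─ₗ P∈L)
countContaining-─ₗ i (P ∷ L) (here refl) = countContaining-∷ i P L
countContaining-─ₗ i {P} (Q ∷ L) (there P∈L) = begin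
  countContaining i (Q ∷ L)                                     ≡⟨ countContaining-∷ i Q L ⟩
  indicator Q i + countContaining i L                           ≡⟨ cong (indicator Q i +_) (countContaining-─ₗ i L P∈L) ⟩
  indicator Q i + (indicator P i + countContaining i (L ─ₗ P∈L)) ≡⟨ x∙yz≈y∙xz (indicator Q i) (indicator P i) _ ⟩
  indicator P i + (indicator Q i + countContaining i (L ─ₗ P∈L)) ≡⟨ cong (indicator P i +_) (countContaining-∷ i Q (L ─ₗ P∈L)) ⟨
  indicator P i + countContaining i (Q ∷ (L ─ₗ P∈L))             ∎

∈-─ₗ⇒∈ : ∀ {P Q : Subset m} L (P∈L : P ∈L L) → Q ∈L (L ─ₗ P∈L) → Q ∈L L
∈-─ₗ⇒∈ (_ ∷ L) (here _)    Q∈rest         = there Q∈rest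
∈-─ₗ⇒∈ (_ ∷ L) (there P∈L) (here Q≡R)     = here Q≡R
∈-─ₗ⇒∈ (_ ∷ L) (there P∈L) (there Q∈rest) = there (∈-─ₗ⇒∈ L P∈L Q∈rest)

countContaining≢0⇒∃ : ∀ (i : Fin m) L → countContaining i L ≢ 0 → Σ (Subset m) λ P → P ∈L L × i ∈ P
countContaining≢0⇒∃ i []      count≢0 = contradiction refl count≢0
countContaining≢0⇒∃ i (P ∷ L) count≢0 with i ∈? P
... | yes i∈P = P , here refl , i∈P
... | no _ with countContaining≢0⇒∃ i L count≢0
...   | Q , Q∈L , i∈Q = Q , there Q∈L , i∈Q

module _ {I : Instance} {L : List (Subset (n I))} (packing : PerfectPacking I L) where
  open PerfectPacking packing

  part-containing : ∀ i → Σ (Subset (n I)) λ P → P ∈L L × i ∈ P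
  part-containing i = countContaining≢0⇒∃ i L (λ count≡0 → 1+n≢0 (trans (sym (partition i)) count≡0))

  other-part-containing : ∀ {P i} (P∈L : P ∈L L) → i ∉ P →
    Σ (Subset (n I)) λ Q → Q ∈L (L ─ₗ P∈L) × i ∈ Q
  other-part-containing {P} {i} P∈L i∉P = countContaining≢0⇒∃ i (L ─ₗ P∈L) λ count≡0 →
    1+n≢0 (begin
      1                                                  ≡⟨ partition i ⟨
      countContaining i L                                ≡⟨ countContaining-─ₗ i L P∈L ⟩
      indicator P i + countContaining i (L ─ₗ P∈L)        ≡⟨ cong₂ _+_ (indicator-∉ i∉P) count≡0 ⟩
      0                                                  ∎)

  module _ {P Q} (P∈L : P ∈L L) (Q∈rest : Q ∈L (L ─ₗ P∈L)) where
    rest : List (Subset (n I))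
    rest = L ─ₗ P∈L ─ₗ Q∈rest

    countContaining-two-parts : ∀ i → indicator P i + (indicator Q i + countContaining i rest) ≡ 1
    countContaining-two-parts i = begin
      indicator P i + (indicator Q i + countContaining i rest)
        ≡⟨ cong (indicator P i +_) (countContaining-─ₗ i (L ─ₗ P∈L) Q∈rest) ⟨
      indicator P i + countContaining i (L ─ₗ P∈L)
        ≡⟨ countContaining-─ₗ i L P∈L ⟨
      countContaining i L
        ≡⟨ partition i ⟩
      1 ∎

    distinct-parts-disjoint : Disjoint P Q
    distinct-parts-disjoint {i} i∈P i∈Q with countContaining-two-parts i
    ... | count≡1 rewrite indicator-∈ i∈P | indicator-∈ i∈Q = 1+n≢0 (suc-injective count≡1)

    exchange : ∀ {T} → FullPattern I T → T ⊆ P ∪ Q →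
      Σ (List (Subset (n I))) λ parts → PerfectPacking I parts × T ∈L parts
    exchange {T} full-T T⊆P∪Q = T ∷ N ∷ rest , record { allFull = full ; partition = covered } , here refl
      where
      N : Subset (n I)
      N = (P ∪ Q) ─ T

      T+N≡P+Q : ∀ i → indicator T i + indicator N i ≡ indicator P i + indicator Q i
      T+N≡P+Q i = trans (indicator-─ T⊆P∪Q) (sym (indicator-∪ distinct-parts-disjoint))

      full-N : FullPattern I N
      full-N = +-cancelˡ-≡ (W I) _ _ (begin
        W I + weightOf (w I) N               ≡⟨ cong (_+ weightOf (w I) N) full-T ⟨
        weightOf (w I) T + weightOf (w I) N  ≡⟨ weightOf-─ (w I) T⊆P∪Q ⟩
        weightOf (w I) (P ∪ Q)               ≡⟨ weightOf-∪ (w I) distinct-parts-disjoint ⟨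
        weightOf (w I) P + weightOf (w I) Q  ≡⟨ cong₂ _+_ (allFull P P∈L) (allFull Q (∈-─ₗ⇒∈ L P∈L Q∈rest)) ⟩
        W I + W I                            ∎)

      full : ∀ R → R ∈L (T ∷ N ∷ rest) → FullPattern I R
      full R (here refl)         = full-T
      full R (there (here refl)) = full-N
      full R (there (there R∈rest)) =
        allFull R (∈-─ₗ⇒∈ L P∈L (∈-─ₗ⇒∈ (L ─ₗ P∈L) Q∈rest R∈rest))

      covered : ∀ i → countContaining i (T ∷ N ∷ rest) ≡ 1
      covered i = begin
        countContaining i (T ∷ N ∷ rest)
          ≡⟨ trans (countContaining-∷ i T (N ∷ rest)) (cong (indicator T i +_) (countContaining-∷ i N rest)) ⟩
        indicator T i + (indicator N i + countContaining i rest)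
          ≡⟨ +-assoc (indicator T i) _ _ ⟨
        (indicator T i + indicator N i) + countContaining i rest
          ≡⟨ cong (_+ countContaining i rest) (T+N≡P+Q i) ⟩
        (indicator P i + indicator Q i) + countContaining i rest
          ≡⟨ +-assoc (indicator P i) _ _ ⟩
        indicator P i + (indicator Q i + countContaining i rest)
          ≡⟨ countContaining-two-parts i ⟩
        1 ∎

theorem3 : (I : Instance) → (a b c : Fin (n I)) →
    a ≢ b → a ≢ c → b ≢ c →
    w I a + w I b + w I c ≡ W I →
    ¬ (Σ (Subset (n I)) λ P → FullPattern I P × a ∈ P ×
    (∀ i → i ∈ P → i ≢ a → (i ≢ b × i ≢ c))) →
    (Σ (List (Subset (n I))) λ parts → PerfectPacking I parts) →
    Σ (List (Subset (n I))) λ parts → PerfectPacking I parts × triple a b c ∈L parts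
theorem3 I a b c a≢b a≢c b≢c sum≡W no-pattern (L , packing) =
  make-part (trans (weightOf-triple (w I) a≢b a≢c b≢c) sum≡W)
  where
  open PerfectPacking packing
  T : Subset (n I)
  T = triple a b c

  ∉⇒≢ : ∀ {P x i} → x ∉ P → i ∈ P → i ≢ x
  ∉⇒≢ x∉P i∈P refl = x∉P i∈P

  make-part : FullPattern I T → Σ (List (Subset (n I))) λ parts → PerfectPacking I parts × T ∈L parts
  make-part full-T with part-containing packing a
  ... | P , P∈L , a∈P with b ∈? P | c ∈? P
  ... | yes b∈P | yes c∈P =
    L , packing , subst (_∈L L) (sym (full-⊆⇒≡ I (triple⊆ a∈P b∈P c∈P) full-T (allFull P P∈L))) P∈L
  ... | yes b∈P | no c∉P with Q , Q∈rest , c∈Q ← other-part-containing packing P∈L c∉P =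
    exchange packing P∈L Q∈rest full-T (triple⊆ (x∈p∪q⁺ (inj₁ a∈P)) (x∈p∪q⁺ (inj₁ b∈P)) (x∈p∪q⁺ (inj₂ c∈Q)))
  ... | no b∉P | yes c∈P with Q , Q∈rest , b∈Q ← other-part-containing packing P∈L b∉P =
    exchange packing P∈L Q∈rest full-T (triple⊆ (x∈p∪q⁺ (inj₁ a∈P)) (x∈p∪q⁺ (inj₂ b∈Q)) (x∈p∪q⁺ (inj₁ c∈P)))
  ... | no b∉P | no c∉P =
    ⊥-elim (no-pattern (P , allFull P P∈L , a∈P , λ i i∈P _ → ∉⇒≢ b∉P i∈P , ∉⇒≢ c∉P i∈P))
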